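{- Let $W_1,W_2$ be weighted strings over an alphabet $\Sigma$ and let $S_1,S_2$ be standard strings with $|S_1|=|W_1|$, $|S_2|=|W_2|$, $\mathbb{P}(S_1,W_1)\ge\tfrac1z$ and $\mathbb{P}(S_2,W_2)\ge\tfrac1z$. Then \[\bigl|\,|\mathrm{SCS}(S_1,S_2)| - |\mathrm{SCS}(\mathcal{H}(W_1),\mathcal{H}(W_2))|\,\bigr|\le 2\log_2 z.\]
   Context: A weighted string $W=W[1]\cdots W[n]$ over $\Sigma$ is a sequence of probability distributions on $\Sigma$, with $\pi^{(W)}_i(c)$ the probability of letter $c$ at position $i$; for $S\in\Sigma^n$, $\mathbb{P}(S,W)=\prod_i\pi^{(W)}_i(S[i])$. The heavy string $\mathcal{H}(W)$ is the standard string of length $n$ whose $i$-th letter is a letter $c$ maximizing $\pi^{(W)}_i(c)$ (ties broken arbitrarily). $|\mathrm{SCS}(X,Y)|$ denotes the length of a shortest common supersequence of standard strings $X$ and $Y$ (a shortest string having both $X$ and $Y$ as subsequences).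
   Formalization: The letter probabilities $\pi^{(W)}_i(c)$ of both weighted strings and the threshold z take rational values. -}

module Defs where

open import Data.Nat as ℕ using (ℕ)
open import Data.Fin using (Fin)
open import Data.Vec using (Vec; toList; lookup; foldr; zipWith; allFin)
open import Data.List using (List; length)
open import Data.List.Relation.Binary.Sublist.Propositional using (_⊆_)
open import Data.Product using (Σ; _×_)
open import Relation.Binary.PropositionalEquality using (_≡_)
open import Data.Rational using (ℚ; 0ℚ; 1ℚ; _+_; _*_; _≤_)

Dist : ℕ → Set
Dist σ = Fin σ → ℚ

sumℚ : ∀ {m} → Vec ℚ m → ℚ
sumℚ = foldr _ _+_ 0ℚ

prodℚ : ∀ {m} → Vec ℚ m → ℚ
prodℚ = foldr _ _*_ 1ℚ

IsDist : ∀ {σ} → Dist σ → Set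
IsDist {σ} p = (∀ c → 0ℚ ≤ p c) × (sumℚ (Data.Vec.map p (allFin σ)) ≡ 1ℚ)

WeightedString : ℕ → ℕ → Set
WeightedString σ n = Vec (Dist σ) n

IsWeightedString : ∀ {σ n} → WeightedString σ n → Set
IsWeightedString W = ∀ i → IsDist (lookup W i)

Prob : ∀ {σ n} → Vec (Fin σ) n → WeightedString σ n → ℚ
Prob S W = prodℚ (zipWith (λ c p → p c) S W)

-- H is a heavy string of W (any tie-breaking): each letter maximizes π_i.
IsHeavy : ∀ {σ n} → WeightedString σ n → Vec (Fin σ) n → Set
IsHeavy W H = ∀ i c → lookup W i c ≤ lookup W i (lookup H i)

IsSCSLength : ∀ {σ} → List (Fin σ) → List (Fin σ) → ℕ → Set
IsSCSLength X Y k =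
  Σ (List _) (λ Z → (length Z ≡ k) × (X ⊆ Z) × (Y ⊆ Z))
  × (∀ Z → X ⊆ Z → Y ⊆ Z → k ℕ.≤ length Z)

-- A position where S differs from a heavy string H carries probability at most 1/2 (S[i] and
-- H[i] are distinct letters and H[i] is the likelier one), so P(S, W) ≥ 1/z forces
-- 2^d ≤ z, where d is the Hamming distance of S and H.  Changing d letters of a subsequence of
-- Z costs at most d insertions into Z, so the SCS lengths of (S₁, S₂) and (H₁, H₂) differ by at
-- most d₁ + d₂, whence 2^∣k - k′∣ ≤ 2^d₁ · 2^d₂ ≤ z².
module Submission where

open import Defs
open import Data.Nat using (ℕ; _^_; ∣_-_∣)
open import Data.Fin using (Fin)
open import Data.Vec using (Vec; toList)
open import Data.Integer using (+_)
open import Data.Rational using (ℚ; 0ℚ; _<_; _≤_; _*_; _/_; 1/_; NonZero)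

open import Algebra.Bundles using (CommutativeMonoid)
open import Data.Fin as Fin using (zero; suc)
import Data.Integer as ℤ
import Data.Integer.Properties as ℤ
open import Data.List using (List; []; _∷_; length)
open import Data.List.Relation.Binary.Sublist.Propositional
  using (_⊆_; []; _∷_; _∷ʳ_; ⊆-trans)
open import Data.Nat as ℕ using (zero; suc; z≤n; s≤s)
open import Data.Nat.Coprimality as Coprime using (1-coprimeTo)
import Data.Nat.Properties as ℕ
open import Data.Product using (∃-syntax; _×_; _,_; proj₁; proj₂)
open import Data.Rational using (1ℚ; _+_; toℚᵘ; nonNegative)
import Data.Rational.Properties as ℚ
open import Data.Rational.Unnormalised as ℚᵘ using (mkℚᵘ)
import Data.Rational.Unnormalised.Properties as ℚᵘ
open import Data.Vec as Vec using ([]; _∷_; lookup; allFin)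
import Data.Vec.Properties as Vec
open import Function using (_∘_)
open import Relation.Binary.Definitions using (DecidableEquality)
open import Relation.Binary.PropositionalEquality
open import Relation.Nullary using (yes; no; contradiction)

open import Algebra.Properties.CommutativeSemigroup
  (CommutativeMonoid.commutativeSemigroup ℚ.*-1-commutativeMonoid) using (interchange)

module Hamming {a} {A : Set a} (_≟_ : DecidableEquality A) where

  mismatch : A → A → ℕ
  mismatch x y with x ≟ y
  ... | yes _ = 0
  ... | no  _ = 1

  -- The surplus tail of the longer list is ignored; all uses are on lists of equal length.
  hamming : List A → List A → ℕ
  hamming (x ∷ xs) (y ∷ ys) = mismatch x y ℕ.+ hamming xs ys
  hamming _        _        = 0

  mismatch-comm : ∀ x y → mismatch x y ≡ mismatch y x
  mismatch-comm x y with x ≟ y | y ≟ x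
  ... | yes _   | yes _   = refl
  ... | no  _   | no  _   = refl
  ... | yes x≡y | no  y≢x = contradiction (sym x≡y) y≢x
  ... | no  x≢y | yes y≡x = contradiction (sym y≡x) x≢y

  hamming-comm : ∀ xs ys → hamming xs ys ≡ hamming ys xs
  hamming-comm []       []       = refl
  hamming-comm []       (_ ∷ _)  = refl
  hamming-comm (_ ∷ _)  []       = refl
  hamming-comm (x ∷ xs) (y ∷ ys) = cong₂ ℕ._+_ (mismatch-comm x y) (hamming-comm xs ys)

  ⊆-substitute : ∀ {X Z} → X ⊆ Z → ∀ Y → length X ≡ length Y →
                 ∃[ Z′ ] Y ⊆ Z′ × Z ⊆ Z′ × length Z′ ℕ.≤ length Z ℕ.+ hamming X Y
  ⊆-substitute []        []       _  = [] , [] , [] , z≤n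
  ⊆-substitute (z ∷ʳ X⊆Z) Y       eq with ⊆-substitute X⊆Z Y eq
  ... | Z′ , Y⊆Z′ , Z⊆Z′ , ∣Z′∣≤ = z ∷ Z′ , z ∷ʳ Y⊆Z′ , refl ∷ Z⊆Z′ , s≤s ∣Z′∣≤
  ⊆-substitute {x ∷ X} (refl ∷ X⊆Z) (y ∷ Y) eq
    with ⊆-substitute X⊆Z Y (ℕ.suc-injective eq) | x ≟ y
  ... | Z′ , Y⊆Z′ , Z⊆Z′ , ∣Z′∣≤ | yes refl =
    x ∷ Z′ , refl ∷ Y⊆Z′ , refl ∷ Z⊆Z′ , s≤s ∣Z′∣≤
  ... | Z′ , Y⊆Z′ , Z⊆Z′ , ∣Z′∣≤ | no  _    =
    y ∷ x ∷ Z′ , refl ∷ x ∷ʳ Y⊆Z′ , y ∷ʳ refl ∷ Z⊆Z′ ,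
    s≤s (ℕ.≤-trans (s≤s ∣Z′∣≤) (ℕ.≤-reflexive (sym (ℕ.+-suc _ _))))

  common-⊆-substitute : ∀ {X₁ X₂ Y₁ Y₂ Z} → length X₁ ≡ length Y₁ → length X₂ ≡ length Y₂ →
                        X₁ ⊆ Z → X₂ ⊆ Z →
                        ∃[ Z′ ] Y₁ ⊆ Z′ × Y₂ ⊆ Z′ ×
                                length Z′ ℕ.≤ length Z ℕ.+ (hamming X₁ Y₁ ℕ.+ hamming X₂ Y₂)
  common-⊆-substitute {X₁} {X₂} {Y₁} {Y₂} {Z} eq₁ eq₂ X₁⊆Z X₂⊆Z
    with ⊆-substitute X₁⊆Z Y₁ eq₁
  ... | Z₁ , Y₁⊆Z₁ , Z⊆Z₁ , ∣Z₁∣≤ with ⊆-substitute (⊆-trans X₂⊆Z Z⊆Z₁) Y₂ eq₂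
  ... | Z₂ , Y₂⊆Z₂ , Z₁⊆Z₂ , ∣Z₂∣≤ = Z₂ , ⊆-trans Y₁⊆Z₁ Z₁⊆Z₂ , Y₂⊆Z₂ , (begin
    length Z₂                                       ≤⟨ ∣Z₂∣≤ ⟩
    length Z₁ ℕ.+ hamming X₂ Y₂                     ≤⟨ ℕ.+-monoˡ-≤ _ ∣Z₁∣≤ ⟩
    length Z ℕ.+ hamming X₁ Y₁ ℕ.+ hamming X₂ Y₂    ≡⟨ ℕ.+-assoc (length Z) _ _ ⟩
    length Z ℕ.+ (hamming X₁ Y₁ ℕ.+ hamming X₂ Y₂)  ∎)
    where open ℕ.≤-Reasoning

m≤n+o∧n≤m+o⇒∣m-n∣≤o : ∀ {m n o} → m ℕ.≤ n ℕ.+ o → n ℕ.≤ m ℕ.+ o → ∣ m - n ∣ ℕ.≤ o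
m≤n+o∧n≤m+o⇒∣m-n∣≤o {zero}  {_}     _         n≤o       = n≤o
m≤n+o∧n≤m+o⇒∣m-n∣≤o {suc _} {zero}  m≤o       _         = m≤o
m≤n+o∧n≤m+o⇒∣m-n∣≤o {suc _} {suc _} (s≤s m≤) (s≤s n≤) = m≤n+o∧n≤m+o⇒∣m-n∣≤o m≤ n≤

module FinHamming {σ : ℕ} = Hamming (Fin._≟_ {σ})
open FinHamming

IsSCSLength⇒≤+hamming : ∀ {σ} {X₁ X₂ Y₁ Y₂ : List (Fin σ)} {k k′} →
                        length X₁ ≡ length Y₁ → length X₂ ≡ length Y₂ →
                        IsSCSLength X₁ X₂ k → IsSCSLength Y₁ Y₂ k′ →
                        k′ ℕ.≤ k ℕ.+ (hamming X₁ Y₁ ℕ.+ hamming X₂ Y₂)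
IsSCSLength⇒≤+hamming eq₁ eq₂ ((Z , refl , X₁⊆Z , X₂⊆Z) , _) (_ , shortest)
  with common-⊆-substitute eq₁ eq₂ X₁⊆Z X₂⊆Z
... | Z′ , Y₁⊆Z′ , Y₂⊆Z′ , ∣Z′∣≤ = ℕ.≤-trans (shortest Z′ Y₁⊆Z′ Y₂⊆Z′) ∣Z′∣≤

IsSCSLength⇒∣-∣≤hamming : ∀ {σ} {X₁ X₂ Y₁ Y₂ : List (Fin σ)} {k k′} →
                          length X₁ ≡ length Y₁ → length X₂ ≡ length Y₂ →
                          IsSCSLength X₁ X₂ k → IsSCSLength Y₁ Y₂ k′ →
                          ∣ k - k′ ∣ ℕ.≤ hamming X₁ Y₁ ℕ.+ hamming X₂ Y₂
IsSCSLength⇒∣-∣≤hamming {X₁ = X₁} {X₂} {Y₁} {Y₂} {k} {k′} eq₁ eq₂ scsX scsY =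
  m≤n+o∧n≤m+o⇒∣m-n∣≤o
    (subst (λ d → k ℕ.≤ k′ ℕ.+ d)
           (cong₂ ℕ._+_ (hamming-comm Y₁ X₁) (hamming-comm Y₂ X₂))
           (IsSCSLength⇒≤+hamming (sym eq₁) (sym eq₂) scsY scsX))
    (IsSCSLength⇒≤+hamming eq₁ eq₂ scsX scsY)

toℚᵘ-/1 : ∀ m → toℚᵘ (+ m / 1) ≡ mkℚᵘ (+ m) 0
toℚᵘ-/1 m = cong toℚᵘ (ℚ.normalize-coprime (Coprime.sym (1-coprimeTo m)))

/1-homo-* : ∀ m n → + (m ℕ.* n) / 1 ≡ (+ m / 1) * (+ n / 1)
/1-homo-* m n = sym (ℚ.toℚᵘ-injective
  (ℚᵘ.≃-trans (ℚ.toℚᵘ-homo-* (+ m / 1) (+ n / 1)) (ℚᵘ.≃-reflexive (begin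
    toℚᵘ (+ m / 1) ℚᵘ.* toℚᵘ (+ n / 1)  ≡⟨ cong₂ ℚᵘ._*_ (toℚᵘ-/1 m) (toℚᵘ-/1 n) ⟩
    mkℚᵘ (+ m ℤ.* + n) 0                 ≡⟨ cong (λ i → mkℚᵘ i 0) (ℤ.pos-* m n) ⟨
    mkℚᵘ (+ (m ℕ.* n)) 0                 ≡⟨ toℚᵘ-/1 (m ℕ.* n) ⟨
    toℚᵘ (+ (m ℕ.* n) / 1)               ∎))))
  where open ≡-Reasoning

/1-mono-≤ : ∀ {m n} → m ℕ.≤ n → + m / 1 ≤ + n / 1
/1-mono-≤ {m} {n} m≤n = ℚ.toℚᵘ-cancel-≤ (subst₂ ℚᵘ._≤_ (sym (toℚᵘ-/1 m)) (sym (toℚᵘ-/1 n))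
  (ℚᵘ.*≤* (ℤ.*-monoʳ-≤-nonNeg (+ 1) (ℤ.+≤+ m≤n))))

2^_ : ℕ → ℚ
2^ n = + (2 ^ n) / 1

2^-nonNeg : ∀ n → 0ℚ ≤ 2^ n
2^-nonNeg n = ℚ.nonNegative⁻¹ (2^ n) {{ℚ.normalize-nonNeg (2 ^ n) 1}}

2^-homo-+ : ∀ m n → 2^ (m ℕ.+ n) ≡ 2^ m * 2^ n
2^-homo-+ m n = trans (cong (λ k → + k / 1) (ℕ.^-distribˡ-+-* 2 m n)) (/1-homo-* (2 ^ m) (2 ^ n))

2^-mono-≤ : ∀ {m n} → m ℕ.≤ n → 2^ m ≤ 2^ n
2^-mono-≤ m≤n = /1-mono-≤ (ℕ.^-monoʳ-≤ 2 m≤n)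

private
  nonNeg*nonNeg : ∀ {p q} → 0ℚ ≤ p → 0ℚ ≤ q → 0ℚ ≤ p * q
  nonNeg*nonNeg {p} {q} 0≤p 0≤q =
    ℚ.nonNegative⁻¹ _ {{ℚ.nonNeg*nonNeg⇒nonNeg p {{nonNegative 0≤p}} q {{nonNegative 0≤q}}}}

  *-monoˡ-≤-0≤ : ∀ {r p q} → 0ℚ ≤ r → p ≤ q → r * p ≤ r * q
  *-monoˡ-≤-0≤ {r} 0≤r = ℚ.*-monoˡ-≤-nonNeg r {{nonNegative 0≤r}}

  *-monoʳ-≤-0≤ : ∀ {r p q} → 0ℚ ≤ r → p ≤ q → p * r ≤ q * r
  *-monoʳ-≤-0≤ {r} 0≤r = ℚ.*-monoʳ-≤-nonNeg r {{nonNegative 0≤r}}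

  p≤q+p : ∀ {p q} → 0ℚ ≤ q → p ≤ q + p
  p≤q+p {p} {q} 0≤q = subst (_≤ q + p) (ℚ.+-identityˡ p) (ℚ.+-monoˡ-≤ p 0≤q)

  p≤p+q : ∀ {p q} → 0ℚ ≤ q → p ≤ p + q
  p≤p+q {p} {q} 0≤q = subst (p ≤_) (ℚ.+-comm q p) (p≤q+p 0≤q)

sumℚ-nonNeg : ∀ {m} (v : Vec ℚ m) → (∀ i → 0ℚ ≤ lookup v i) → 0ℚ ≤ sumℚ v
sumℚ-nonNeg []      _   = ℚ.≤-refl
sumℚ-nonNeg (x ∷ v) 0≤v = ℚ.≤-trans (sumℚ-nonNeg v (0≤v ∘ suc)) (p≤q+p (0≤v zero))

lookup≤sumℚ : ∀ {m} (v : Vec ℚ m) → (∀ i → 0ℚ ≤ lookup v i) → ∀ i → lookup v i ≤ sumℚ v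
lookup≤sumℚ (x ∷ v) 0≤v zero    = p≤p+q (sumℚ-nonNeg v (0≤v ∘ suc))
lookup≤sumℚ (x ∷ v) 0≤v (suc i) = ℚ.≤-trans (lookup≤sumℚ v (0≤v ∘ suc) i) (p≤q+p (0≤v zero))

lookup+lookup≤sumℚ : ∀ {m} (v : Vec ℚ m) → (∀ i → 0ℚ ≤ lookup v i) →
                     ∀ {i j} → i ≢ j → lookup v i + lookup v j ≤ sumℚ v
lookup+lookup≤sumℚ (x ∷ v) 0≤v {zero}  {zero}  i≢j = contradiction refl i≢j
lookup+lookup≤sumℚ (x ∷ v) 0≤v {zero}  {suc j} _   =
  ℚ.+-monoʳ-≤ x (lookup≤sumℚ v (0≤v ∘ suc) j)
lookup+lookup≤sumℚ (x ∷ v) 0≤v {suc i} {zero}  _   =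
  subst (_≤ x + sumℚ v) (ℚ.+-comm x _) (ℚ.+-monoʳ-≤ x (lookup≤sumℚ v (0≤v ∘ suc) i))
lookup+lookup≤sumℚ (x ∷ v) 0≤v {suc i} {suc j} i≢j =
  ℚ.≤-trans (lookup+lookup≤sumℚ v (0≤v ∘ suc) (i≢j ∘ cong suc)) (p≤q+p (0≤v zero))

module _ {σ} {p : Dist σ} (p-dist : IsDist p) where

  private
    probabilities : Vec ℚ σ
    probabilities = Vec.map p (allFin σ)

    lookup-probabilities : ∀ c → lookup probabilities c ≡ p c
    lookup-probabilities c = trans (Vec.lookup-map c p (allFin σ)) (cong p (Vec.lookup-allFin c))

    probabilities-nonNeg : ∀ c → 0ℚ ≤ lookup probabilities c
    probabilities-nonNeg c = subst (0ℚ ≤_) (sym (lookup-probabilities c)) (proj₁ p-dist c)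

  IsDist⇒≤1 : ∀ c → p c ≤ 1ℚ
  IsDist⇒≤1 c = subst₂ _≤_ (lookup-probabilities c) (proj₂ p-dist)
    (lookup≤sumℚ probabilities probabilities-nonNeg c)

  IsDist⇒+≤1 : ∀ {c d} → c ≢ d → p c + p d ≤ 1ℚ
  IsDist⇒+≤1 {c} {d} c≢d = subst₂ _≤_ (cong₂ _+_ (lookup-probabilities c) (lookup-probabilities d))
    (proj₂ p-dist) (lookup+lookup≤sumℚ probabilities probabilities-nonNeg c≢d)

  IsDist⇒*2^mismatch≤1 : ∀ {h} → (∀ c → p c ≤ p h) → ∀ s → p s * 2^ mismatch s h ≤ 1ℚ
  IsDist⇒*2^mismatch≤1 {h} heavy s with s Fin.≟ h
  ... | yes _   = subst (_≤ 1ℚ) (sym (ℚ.*-identityʳ (p s))) (IsDist⇒≤1 s)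
  ... | no  s≢h = begin
    p s * 2^ 1           ≡⟨⟩
    p s * (1ℚ + 1ℚ)      ≡⟨ ℚ.*-distribˡ-+ (p s) 1ℚ 1ℚ ⟩
    p s * 1ℚ + p s * 1ℚ  ≡⟨ cong₂ _+_ (ℚ.*-identityʳ (p s)) (ℚ.*-identityʳ (p s)) ⟩
    p s + p s            ≤⟨ ℚ.+-monoʳ-≤ (p s) (heavy s) ⟩
    p s + p h            ≤⟨ IsDist⇒+≤1 s≢h ⟩
    1ℚ                   ∎
    where open ℚ.≤-Reasoning

Prob-nonNeg : ∀ {σ n} {W : WeightedString σ n} → IsWeightedString W → ∀ S → 0ℚ ≤ Prob S W
Prob-nonNeg {W = []}    _      []      = ℚ.nonNegative⁻¹ 1ℚ
Prob-nonNeg {W = w ∷ W} W-dist (s ∷ S) =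
  nonNeg*nonNeg (proj₁ (W-dist zero) s) (Prob-nonNeg (W-dist ∘ suc) S)

Prob*2^hamming≤1 : ∀ {σ n} {W : WeightedString σ n} {H} → IsWeightedString W → IsHeavy W H →
                   ∀ S → Prob S W * 2^ hamming (toList S) (toList H) ≤ 1ℚ
Prob*2^hamming≤1 {W = []}    {[]}    _      _     []      = ℚ.≤-refl
Prob*2^hamming≤1 {W = w ∷ W} {h ∷ H} W-dist heavy (s ∷ S) = begin
  w s * P * 2^ (mismatch s h ℕ.+ d)  ≡⟨ cong (w s * P *_) (2^-homo-+ (mismatch s h) d) ⟩
  w s * P * (2^ mismatch s h * 2^ d) ≡⟨ interchange (w s) P _ _ ⟩
  w s * 2^ mismatch s h * (P * 2^ d) ≤⟨ *-monoʳ-≤-0≤ (nonNeg*nonNeg (Prob-nonNeg (W-dist ∘ suc) S) (2^-nonNeg d))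
                                          (IsDist⇒*2^mismatch≤1 (W-dist zero) (heavy zero) s) ⟩
  1ℚ * (P * 2^ d)                    ≡⟨ ℚ.*-identityˡ (P * 2^ d) ⟩
  P * 2^ d                           ≤⟨ Prob*2^hamming≤1 (W-dist ∘ suc) (heavy ∘ suc) S ⟩
  1ℚ                                 ∎
  where
  open ℚ.≤-Reasoning
  P = Prob S W
  d = hamming (toList S) (toList H)

1/z≤p∧p*x≤1⇒x≤z : ∀ {z p x} .{{_ : NonZero z}} → 0ℚ < z → 0ℚ ≤ x → 1/ z ≤ p → p * x ≤ 1ℚ → x ≤ z
1/z≤p∧p*x≤1⇒x≤z {z} {p} {x} 0<z 0≤x 1/z≤p p*x≤1 = begin
  x              ≡⟨ ℚ.*-identityˡ x ⟨
  1ℚ * x         ≡⟨ cong (_* x) (ℚ.*-inverseʳ z) ⟨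
  z * 1/ z * x   ≡⟨ ℚ.*-assoc z (1/ z) x ⟩
  z * (1/ z * x) ≤⟨ *-monoˡ-≤-0≤ (ℚ.<⇒≤ 0<z) (*-monoʳ-≤-0≤ 0≤x 1/z≤p) ⟩
  z * (p * x)    ≤⟨ *-monoˡ-≤-0≤ (ℚ.<⇒≤ 0<z) p*x≤1 ⟩
  z * 1ℚ         ≡⟨ ℚ.*-identityʳ z ⟩
  z              ∎
  where open ℚ.≤-Reasoning

2^hamming≤z : ∀ {σ n} {W : WeightedString σ n} {H} → IsWeightedString W → IsHeavy W H →
              ∀ S (z : ℚ) .{{_ : NonZero z}} → 0ℚ < z → 1/ z ≤ Prob S W →
              2^ hamming (toList S) (toList H) ≤ z
2^hamming≤z {H = H} W-dist heavy S z 0<z 1/z≤P =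
  1/z≤p∧p*x≤1⇒x≤z 0<z (2^-nonNeg (hamming (toList S) (toList H))) 1/z≤P (Prob*2^hamming≤1 W-dist heavy S)

lemma12 : ∀ {σ n₁ n₂} (W₁ : WeightedString σ n₁) (W₂ : WeightedString σ n₂)
          → IsWeightedString W₁ → IsWeightedString W₂
          → (S₁ : Vec (Fin σ) n₁) (S₂ : Vec (Fin σ) n₂)
          → (H₁ : Vec (Fin σ) n₁) (H₂ : Vec (Fin σ) n₂)
          → IsHeavy W₁ H₁ → IsHeavy W₂ H₂
          → (z : ℚ) .{{_ : NonZero z}} → 0ℚ < z
          → 1/ z ≤ Prob S₁ W₁ → 1/ z ≤ Prob S₂ W₂
          → (k k′ : ℕ)
          → IsSCSLength (toList S₁) (toList S₂) k
          → IsSCSLength (toList H₁) (toList H₂) k′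
          → ((+ (2 ^ ∣ k - k′ ∣)) / 1) ≤ z * z
lemma12 W₁ W₂ W₁-dist W₂-dist S₁ S₂ H₁ H₂ H₁-heavy H₂-heavy z 0<z 1/z≤P₁ 1/z≤P₂ k k′ scsS scsH =
  begin
    2^ ∣ k - k′ ∣   ≤⟨ 2^-mono-≤ (IsSCSLength⇒∣-∣≤hamming (same-length S₁ H₁) (same-length S₂ H₂) scsS scsH) ⟩
    2^ (d₁ ℕ.+ d₂)  ≡⟨ 2^-homo-+ d₁ d₂ ⟩
    2^ d₁ * 2^ d₂   ≤⟨ *-monoʳ-≤-0≤ (2^-nonNeg d₂) (2^hamming≤z W₁-dist H₁-heavy S₁ z 0<z 1/z≤P₁) ⟩
    z * 2^ d₂       ≤⟨ *-monoˡ-≤-0≤ (ℚ.<⇒≤ 0<z) (2^hamming≤z W₂-dist H₂-heavy S₂ z 0<z 1/z≤P₂) ⟩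
    z * z           ∎
  where
  open ℚ.≤-Reasoning
  d₁ = hamming (toList S₁) (toList H₁)
  d₂ = hamming (toList S₂) (toList H₂)
  same-length : ∀ {n} (xs ys : Vec (Fin _) n) → length (toList xs) ≡ length (toList ys)
  same-length xs ys = trans (Vec.length-toList xs) (sym (Vec.length-toList ys))
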